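{- For integers $k\geq1$, $p\geq2$ and any integer $m$, \begin{align*} &\sum_{n=0}^\infty(-1)^{\lfloor n/k\rfloor}\frac{F_{n+m}}{p^{n+1}}\\ &=\frac{(p^{2k}-(-1)^k)(pF_m+F_{m-1})-p^k(pF_{k+m}+F_{k+m-1})+(-1)^mp^k(F_{k-m+1}-pF_{k-m})}{(p^2-p-1)\big(p^{2k}+p^kL_k+(-1)^k\big)}, \end{align*} and \begin{align*} &\sum_{n=0}^\infty(-1)^{\lfloor n/k\rfloor}\frac{L_{n+m}}{p^{n+1}}\\ &=\frac{(p^{2k}-(-1)^k)(pL_m+L_{m-1})-p^k(pL_{k+m}+L_{k+m-1})-(-1)^mp^k(L_{k-m+1}-pL_{k-m})}{(p^2-p-1)\big(p^{2k}+p^kL_k+(-1)^k\big)}. \end{align*}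
   Context: $F_n$ and $L_n$ are the Fibonacci and Lucas numbers ($F_0=0,F_1=1$, $L_0=2,L_1=1$, $X_n=X_{n-1}+X_{n-2}$), extended to negative indices by $F_{ -n}=(-1)^{n-1}F_n$, $L_{ -n}=(-1)^nL_n$. $\lfloor x\rfloor$ is the floor function. -}

module Defs where

open import Data.Nat as ℕ using (ℕ; zero; suc; NonZero)
open import Data.Nat.DivMod using (_/_)
open import Data.Integer as ℤ using (ℤ; +_; -[1+_])
open import Data.Rational as ℚ using (ℚ; 0ℚ; _÷_; ≢-nonZero)
open import Data.Rational.Properties using (_≟_)
open import Relation.Nullary using (yes; no)
open import Data.Product using (∃)

fibℕ : ℕ → ℤ
fibℕ 0 = + 0
fibℕ 1 = + 1
fibℕ (suc (suc n)) = fibℕ (suc n) ℤ.+ fibℕ n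

lucℕ : ℕ → ℤ
lucℕ 0 = + 2
lucℕ 1 = + 1
lucℕ (suc (suc n)) = lucℕ (suc n) ℤ.+ lucℕ n

sgn : ℕ → ℤ
sgn n = (ℤ.- (+ 1)) ℤ.^ n

-- extension to negative indices: F_{-n} = (-1)^(n-1) F_n, L_{-n} = (-1)^n L_n
F : ℤ → ℤ
F (+ n) = fibℕ n
F -[1+ n ] = sgn n ℤ.* fibℕ (suc n)

L : ℤ → ℤ
L (+ n) = lucℕ n
L -[1+ n ] = sgn (suc n) ℤ.* lucℕ (suc n)

sgnℤ : ℤ → ℤ
sgnℤ m = sgn ℤ.∣ m ∣

-- total division on ℚ (x / 0 := 0); only ever applied to nonzero divisors below
_÷₀_ : ℚ → ℚ → ℚ
x ÷₀ y with y ≟ 0ℚ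
... | yes _ = 0ℚ
... | no y≢0 = _÷_ x y {{≢-nonZero y≢0}}
infixl 7 _÷₀_

partialSum : (ℕ → ℚ) → ℕ → ℚ
partialSum a zero = 0ℚ
partialSum a (suc N) = partialSum a N ℚ.+ a N

SeriesSumsTo : (ℕ → ℚ) → ℚ → Set
SeriesSumsTo a s =
  ∀ (ε : ℚ) → ℚ.0ℚ ℚ.< ε →
    ∃ λ N → ∀ n → N ℕ.≤ n → ℚ.∣ partialSum a n ℚ.- s ∣ ℚ.< ε

term : (X : ℤ → ℤ) (k : ℕ) .{{_ : NonZero k}} (p : ℕ) (m : ℤ) → ℕ → ℚ
term X k p m n =
  ℚ._/_ (sgn (n / k) ℤ.* X (+ n ℤ.+ m)) 1 ÷₀ ℚ._/_ ((+ p) ℤ.^ suc n) 1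

-- Put a i = X (i + m - k - 1) and b i = p a (i + 1) + a i; both are again Fibonacci-like, and
-- (p² - p - 1) a (i + 1) = p b i - b (i + 1), so the k terms of each block of constant sign
-- telescope. The block values Z j = b (j k) satisfy Z (j + 2) = L_k Z (j + 1) - (-1)^k Z j, so the
-- alternating sum over blocks telescopes too. Together this gives the remainder after n terms
-- exactly, and it is O((7/8)^n): Fibonacci-like sequences grow no faster than (7/4)^i, while the
-- denominator of the remainder exceeds 2^n.
module Submission where

open import Defs
open import Data.Nat using (ℕ; NonZero; _≤_) renaming (_*_ to _*ℕ_)
open import Data.Integer using (ℤ; +_; _+_; _-_; _*_; _^_)
open import Data.Rational using (_/_)
open import Data.Product using (_×_)

open import Data.Nat as ℕ using (zero; suc; _<_; z≤n; s≤s)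
import Data.Nat.Properties as ℕP
import Data.Nat.DivMod as ℕDiv
open import Data.Nat.Divisibility using (n∣m*n)
import Data.Nat.Tactic.RingSolver as ℕSolver
open import Data.Integer as ℤ using (-[1+_]; +[1+_]; +0; 1ℤ; -_)
import Data.Integer.Properties as ℤP
open import Data.Integer.Tactic.RingSolver using (solve-∀)
open import Data.Rational as ℚ using (ℚ; mkℚ; ↥_; ↧_; 0ℚ; _÷_; 1/_; ≢-nonZero)
import Data.Rational.Properties as ℚP
import Data.Rational.Unnormalised as ℚᵘ
open import Data.Empty using (⊥-elim)
import Data.Empty.Irrelevant as Irrelevant
open import Data.Product using (_,_; ∃; proj₁; proj₂)
open import Data.Sum using (_⊎_; inj₁; inj₂)
open import Relation.Nullary using (yes; no)
open import Relation.Binary.PropositionalEquality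

sgn-suc : ∀ n → sgn (suc n) ≡ - sgn n
sgn-suc n = ℤP.-1*i≡-i (sgn n)

sgn*sgn≡1 : ∀ n → sgn n * sgn n ≡ 1ℤ
sgn*sgn≡1 zero = refl
sgn*sgn≡1 (suc n) = trans (square-neg (sgn n)) (sgn*sgn≡1 n)
  where
  square-neg : ∀ s → (- 1ℤ * s) * (- 1ℤ * s) ≡ s * s
  square-neg = solve-∀

∣sgn∣≡1 : ∀ n → ℤ.∣ sgn n ∣ ≡ 1
∣sgn∣≡1 zero = refl
∣sgn∣≡1 (suc n) = trans (ℤP.abs-* (- 1ℤ) (sgn n)) (cong (1 ℕ.*_) (∣sgn∣≡1 n))

sgn≡1⊎sgn≡-1 : ∀ n → sgn n ≡ 1ℤ ⊎ sgn n ≡ - 1ℤ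
sgn≡1⊎sgn≡-1 zero = inj₁ refl
sgn≡1⊎sgn≡-1 (suc n) with sgn≡1⊎sgn≡-1 n
... | inj₁ s≡1 = inj₂ (cong (- 1ℤ *_) s≡1)
... | inj₂ s≡-1 = inj₁ (cong (- 1ℤ *_) s≡-1)

sgnℤ-suc : ∀ z → sgnℤ (z + + 1) ≡ - sgnℤ z
sgnℤ-suc (+ n) rewrite ℕP.+-comm n 1 = sgn-suc n
sgnℤ-suc -[1+ zero ] = refl
sgnℤ-suc -[1+ suc n ] = begin
  sgn (suc n)         ≡⟨ ℤP.neg-involutive (sgn (suc n)) ⟨
  - - sgn (suc n)     ≡⟨ cong -_ (sgn-suc (suc n)) ⟨
  - sgn (suc (suc n)) ∎
  where open ≡-Reasoning

sgnℤ-+ : ∀ z j → sgnℤ (z + + j) ≡ sgnℤ z * sgn j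
sgnℤ-+ z zero rewrite ℤP.+-identityʳ z = sym (ℤP.*-identityʳ (sgnℤ z))
sgnℤ-+ z (suc j) = begin
  sgnℤ (z + + suc j)      ≡⟨ cong sgnℤ (reassoc z (+ j)) ⟩
  sgnℤ (z + + j + + 1)    ≡⟨ sgnℤ-suc (z + + j) ⟩
  - sgnℤ (z + + j)        ≡⟨ cong -_ (sgnℤ-+ z j) ⟩
  - (sgnℤ z * sgn j)      ≡⟨ neg-inside (sgnℤ z) (sgn j) ⟩
  sgnℤ z * sgn (suc j)    ∎
  where
  open ≡-Reasoning
  reassoc : ∀ z j → z + (+ 1 + j) ≡ z + j + + 1
  reassoc = solve-∀
  neg-inside : ∀ a b → - (a * b) ≡ a * (- 1ℤ * b)
  neg-inside = solve-∀

F-neg : ∀ z → F (- z) ≡ - (sgnℤ z * F z)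
F-neg (+ zero) = refl
F-neg (+ suc n) = identity (sgn n) (fibℕ (suc n))
  where
  identity : ∀ s f → s * f ≡ - ((- 1ℤ * s) * f)
  identity = solve-∀
F-neg -[1+ n ] = begin
  fibℕ (suc n)                                 ≡⟨ ℤP.*-identityˡ _ ⟨
  1ℤ * fibℕ (suc n)                            ≡⟨ cong (_* fibℕ (suc n)) (sgn*sgn≡1 n) ⟨
  (sgn n * sgn n) * fibℕ (suc n)               ≡⟨ identity (sgn n) (fibℕ (suc n)) ⟩
  - (sgn (suc n) * (sgn n * fibℕ (suc n)))     ∎
  where
  open ≡-Reasoning
  identity : ∀ s f → (s * s) * f ≡ - ((- 1ℤ * s) * (s * f))
  identity = solve-∀

L-neg : ∀ z → L (- z) ≡ sgnℤ z * L z
L-neg (+ zero) = refl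
L-neg (+ suc n) = refl
L-neg -[1+ n ] = begin
  lucℕ (suc n)                                     ≡⟨ ℤP.*-identityˡ _ ⟨
  1ℤ * lucℕ (suc n)                                ≡⟨ cong (_* lucℕ (suc n)) (sgn*sgn≡1 (suc n)) ⟨
  (sgn (suc n) * sgn (suc n)) * lucℕ (suc n)       ≡⟨ ℤP.*-assoc (sgn (suc n)) _ _ ⟩
  sgn (suc n) * (sgn (suc n) * lucℕ (suc n))       ∎
  where open ≡-Reasoning

F-recurrence : ∀ z → F (z + + 2) ≡ F (z + + 1) + F z
F-recurrence (+ n) rewrite ℕP.+-comm n 2 | ℕP.+-comm n 1 = refl
F-recurrence -[1+ zero ] = refl
F-recurrence -[1+ suc zero ] = refl
F-recurrence -[1+ suc (suc n) ] = identity (sgn n) (fibℕ (suc n)) (fibℕ (suc (suc n)))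
  where
  identity : ∀ s f₁ f₂ → s * f₁ ≡ (- 1ℤ * s) * f₂ + (- 1ℤ * (- 1ℤ * s)) * (f₂ + f₁)
  identity = solve-∀

L-recurrence : ∀ z → L (z + + 2) ≡ L (z + + 1) + L z
L-recurrence (+ n) rewrite ℕP.+-comm n 2 | ℕP.+-comm n 1 = refl
L-recurrence -[1+ zero ] = refl
L-recurrence -[1+ suc zero ] = refl
L-recurrence -[1+ suc (suc n) ] = identity (sgn (suc n)) (lucℕ (suc n)) (lucℕ (suc (suc n)))
  where
  identity : ∀ s l₁ l₂ → s * l₁ ≡ (- 1ℤ * s) * l₂ + (- 1ℤ * (- 1ℤ * s)) * (l₂ + l₁)
  identity = solve-∀

Recurrent : (ℕ → ℤ) → Set
Recurrent b = ∀ i → b (suc (suc i)) ≡ b (suc i) + b i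

recurrent-shift : ∀ b → Recurrent b → ∀ j i → b (j ℕ.+ suc i) ≡ fibℕ (suc j) * b (suc i) + fibℕ j * b i
recurrent-shift b rec zero i = identity (b (suc i)) (b i)
  where
  identity : ∀ x y → x ≡ + 1 * x + + 0 * y
  identity = solve-∀
recurrent-shift b rec (suc zero) i = trans (rec i) (identity (b (suc i)) (b i))
  where
  identity : ∀ x y → x + y ≡ + 1 * x + + 1 * y
  identity = solve-∀
recurrent-shift b rec (suc (suc j)) i = begin
  b (suc (suc (j ℕ.+ suc i)))
    ≡⟨ rec (j ℕ.+ suc i) ⟩
  b (suc (j ℕ.+ suc i)) + b (j ℕ.+ suc i)
    ≡⟨ cong₂ _+_ (recurrent-shift b rec (suc j) i) (recurrent-shift b rec j i) ⟩
  (f₂ * b (suc i) + f₁ * b i) + (f₁ * b (suc i) + f₀ * b i)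
    ≡⟨ identity f₂ f₁ f₀ (b (suc i)) (b i) ⟩
  (f₂ + f₁) * b (suc i) + (f₁ + f₀) * b i ∎
  where
  open ≡-Reasoning
  f₀ = fibℕ j
  f₁ = fibℕ (suc j)
  f₂ = fibℕ (suc (suc j))
  identity : ∀ f₂ f₁ f₀ x y → (f₂ * x + f₁ * y) + (f₁ * x + f₀ * y) ≡ (f₂ + f₁) * x + (f₁ + f₀) * y
  identity = solve-∀

cassini : ∀ k → fibℕ (suc (suc k)) * fibℕ k - fibℕ (suc k) * fibℕ (suc k) ≡ sgn (suc k)
cassini zero = refl
cassini (suc k) = trans (identity (fibℕ (suc (suc k))) (fibℕ (suc k)) (fibℕ k))
                        (cong (- 1ℤ *_) (cassini k))
  where
  identity : ∀ f₂ f₁ f₀ → (f₂ + f₁) * f₁ - f₂ * (f₁ + f₀) ≡ - 1ℤ * (f₂ * f₀ - f₁ * f₁)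
  identity = solve-∀

lucℕ≡fibℕ+fibℕ : ∀ k → lucℕ (suc k) ≡ fibℕ (suc (suc k)) + fibℕ k
lucℕ≡fibℕ+fibℕ zero = refl
lucℕ≡fibℕ+fibℕ (suc zero) = refl
lucℕ≡fibℕ+fibℕ (suc (suc k)) =
  trans (cong₂ _+_ (lucℕ≡fibℕ+fibℕ (suc k)) (lucℕ≡fibℕ+fibℕ k))
        (interchange (fibℕ (suc (suc (suc k)))) (fibℕ (suc (suc k))) (fibℕ (suc k)) (fibℕ k))
  where
  interchange : ∀ a b c d → (a + c) + (b + d) ≡ (a + b) + (c + d)
  interchange = solve-∀

recurrent-step : ∀ b → Recurrent b → ∀ k i →
                 b (k ℕ.+ (k ℕ.+ i)) ≡ lucℕ k * b (k ℕ.+ i) - sgn k * b i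
recurrent-step b rec zero i = identity (b i)
  where
  identity : ∀ x → x ≡ + 2 * x - + 1 * x
  identity = solve-∀
recurrent-step b rec (suc k) i = begin
  b (suc (k ℕ.+ suc (k ℕ.+ i)))
    ≡⟨ cong b (ℕP.+-suc k (suc (k ℕ.+ i))) ⟨
  b (k ℕ.+ suc (suc (k ℕ.+ i)))
    ≡⟨ recurrent-shift b rec k (suc (k ℕ.+ i)) ⟩
  f₁ * b (suc (suc (k ℕ.+ i))) + f₀ * b (suc (k ℕ.+ i))
    ≡⟨ cong₂ (λ u v → f₁ * u + f₀ * v) (shift (suc k)) (shift k) ⟩
  f₁ * (f₂ * b₁ + f₁ * b₀) + f₀ * (f₁ * b₁ + f₀ * b₀)
    ≡⟨ identity f₀ f₁ f₂ b₀ b₁ ⟩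
  (f₂ + f₀) * (f₁ * b₁ + f₀ * b₀) - (f₂ * f₀ - f₁ * f₁) * b₀
    ≡⟨ cong₂ (λ u v → u * (f₁ * b₁ + f₀ * b₀) - v * b₀) (sym (lucℕ≡fibℕ+fibℕ k)) (cassini k) ⟩
  lucℕ (suc k) * (f₁ * b₁ + f₀ * b₀) - sgn (suc k) * b₀
    ≡⟨ cong (λ u → lucℕ (suc k) * u - sgn (suc k) * b₀) (shift k) ⟨
  lucℕ (suc k) * b (suc (k ℕ.+ i)) - sgn (suc k) * b₀ ∎
  where
  open ≡-Reasoning
  f₀ = fibℕ k
  f₁ = fibℕ (suc k)
  f₂ = fibℕ (suc (suc k))
  b₀ = b i
  b₁ = b (suc i)
  shift : ∀ j → b (suc (j ℕ.+ i)) ≡ fibℕ (suc j) * b₁ + fibℕ j * b₀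
  shift j = trans (cong b (sym (ℕP.+-suc j i))) (recurrent-shift b rec j i)
  identity : ∀ f₀ f₁ f₂ b₀ b₁ → f₁ * (f₂ * b₁ + f₁ * b₀) + f₀ * (f₁ * b₁ + f₀ * b₀)
             ≡ (f₂ + f₀) * (f₁ * b₁ + f₀ * b₀) - (f₂ * f₀ - f₁ * f₁) * b₀
  identity = solve-∀

-- x ~ E / d means x = E / d when d ≠ 0; for d = 0 it says nothing about x.
infix 4 _~_/_
record _~_/_ (x : ℚ) (E d : ℤ) : Set where
  constructor cross
  field cross-≡ : ↥ x * d ≡ E * ↧ x
open _~_/_

~-cong : ∀ {x y E d} → x ≡ y → x ~ E / d → y ~ E / d
~-cong refl x~E/d = x~E/d

~-/ : ∀ i n .{{_ : ℕ.NonZero n}} → i / n ~ i / + n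
~-/ i (suc n) with ℚP.toℚᵘ-fromℚᵘ (ℚᵘ.mkℚᵘ i n)
... | ℚᵘ.*≡* eq = cross (trans (cong (_* + suc n) (sym (ℚP.↥ᵘ-toℚᵘ (i / suc n))))
                               (trans eq (cong (i *_) (ℚP.↧ᵘ-toℚᵘ (i / suc n)))))

~-resize : ∀ {x E d E′ d′} .{{_ : ℤ.NonZero d}} → x ~ E / d → E * d′ ≡ E′ * d → x ~ E′ / d′
~-resize {x} {E} {d} {E′} {d′} (cross x~E/d) Ed′≡E′d = cross (ℤP.*-cancelʳ-≡ _ _ d (begin
  (↥ x * d′) * d  ≡⟨ swap (↥ x) d′ d ⟩
  (↥ x * d) * d′  ≡⟨ cong (_* d′) x~E/d ⟩
  (E * ↧ x) * d′  ≡⟨ swap E (↧ x) d′ ⟩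
  (E * d′) * ↧ x  ≡⟨ cong (_* ↧ x) Ed′≡E′d ⟩
  (E′ * d) * ↧ x  ≡⟨ swap E′ d (↧ x) ⟩
  (E′ * ↧ x) * d  ∎))
  where
  open ≡-Reasoning
  swap : ∀ a b c → (a * b) * c ≡ (a * c) * b
  swap = solve-∀

~-+ : ∀ {x y E₁ d₁ E₂ d₂} → x ~ E₁ / d₁ → y ~ E₂ / d₂ →
      x ℚ.+ y ~ E₁ * d₂ + E₂ * d₁ / (d₁ * d₂)
~-+ {x@(mkℚ nx dx _)} {y@(mkℚ ny dy _)} {E₁} {d₁} {E₂} {d₂} (cross h₁) (cross h₂) =
  ~-resize (~-/ (nx * + suc dy + ny * + suc dx) (suc dx ℕ.* suc dy)) (begin
    (nx * + suc dy + ny * + suc dx) * (d₁ * d₂)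
      ≡⟨ expand nx ny (+ suc dx) (+ suc dy) d₁ d₂ ⟩
    (nx * d₁) * (+ suc dy * d₂) + (ny * d₂) * (+ suc dx * d₁)
      ≡⟨ cong₂ (λ u v → u * (+ suc dy * d₂) + v * (+ suc dx * d₁)) h₁ h₂ ⟩
    (E₁ * + suc dx) * (+ suc dy * d₂) + (E₂ * + suc dy) * (+ suc dx * d₁)
      ≡⟨ collect E₁ E₂ (+ suc dx) (+ suc dy) d₁ d₂ ⟩
    (E₁ * d₂ + E₂ * d₁) * (+ suc dx * + suc dy)
      ≡⟨ cong ((E₁ * d₂ + E₂ * d₁) *_) (ℤP.pos-* (suc dx) (suc dy)) ⟨
    (E₁ * d₂ + E₂ * d₁) * + (suc dx ℕ.* suc dy) ∎)
  where
  open ≡-Reasoning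
  expand : ∀ nx ny sx sy d₁ d₂ → (nx * sy + ny * sx) * (d₁ * d₂)
           ≡ (nx * d₁) * (sy * d₂) + (ny * d₂) * (sx * d₁)
  expand = solve-∀
  collect : ∀ E₁ E₂ sx sy d₁ d₂ → (E₁ * sx) * (sy * d₂) + (E₂ * sy) * (sx * d₁)
            ≡ (E₁ * d₂ + E₂ * d₁) * (sx * sy)
  collect = solve-∀

~-* : ∀ {x y E₁ d₁ E₂ d₂} → x ~ E₁ / d₁ → y ~ E₂ / d₂ → x ℚ.* y ~ E₁ * E₂ / (d₁ * d₂)
~-* {x@(mkℚ nx dx _)} {y@(mkℚ ny dy _)} {E₁} {d₁} {E₂} {d₂} (cross h₁) (cross h₂) =
  ~-resize (~-/ (nx * ny) (suc dx ℕ.* suc dy)) (begin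
    (nx * ny) * (d₁ * d₂)                   ≡⟨ interchange nx ny d₁ d₂ ⟩
    (nx * d₁) * (ny * d₂)                   ≡⟨ cong₂ _*_ h₁ h₂ ⟩
    (E₁ * + suc dx) * (E₂ * + suc dy)       ≡⟨ interchange E₁ (+ suc dx) E₂ (+ suc dy) ⟩
    (E₁ * E₂) * (+ suc dx * + suc dy)       ≡⟨ cong ((E₁ * E₂) *_) (ℤP.pos-* (suc dx) (suc dy)) ⟨
    (E₁ * E₂) * + (suc dx ℕ.* suc dy)       ∎)
  where
  open ≡-Reasoning
  interchange : ∀ a b c d → (a * b) * (c * d) ≡ (a * c) * (b * d)
  interchange = solve-∀

~-neg : ∀ {x E d} → x ~ E / d → ℚ.- x ~ - E / d
~-neg {x} {E} {d} (cross h) = cross (begin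
  ↥ (ℚ.- x) * d      ≡⟨ cong (_* d) (ℚP.↥-neg x) ⟩
  - ↥ x * d          ≡⟨ ℤP.neg-distribˡ-* (↥ x) d ⟨
  - (↥ x * d)        ≡⟨ cong -_ h ⟩
  - (E * ↧ x)        ≡⟨ ℤP.neg-distribˡ-* E (↧ x) ⟩
  - E * ↧ x          ≡⟨ cong (- E *_) (ℚP.↧-neg x) ⟨
  - E * ↧ (ℚ.- x)    ∎)
  where open ≡-Reasoning

~-1/ : ∀ y .{{_ : ℚ.NonZero y}} → 1/ y ~ ↧ y / ↥ y
~-1/ (mkℚ +[1+ n ] d c) = cross refl
~-1/ (mkℚ -[1+ n ] d c) = cross refl

÷₀-nonZero : ∀ x y (y≢0 : y ≢ 0ℚ) → x ÷₀ y ≡ (x ÷ y) {{≢-nonZero y≢0}}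
÷₀-nonZero x y y≢0 with y ℚP.≟ 0ℚ
... | yes y≡0 = ⊥-elim (y≢0 y≡0)
... | no _ = refl

~-÷₀ : ∀ i j → (i / 1) ÷₀ ((+ suc j) / 1) ~ i / + suc j
~-÷₀ i j = subst (_~ i / + suc j) (sym (÷₀-nonZero (i / 1) y y≢0)) quotient
  where
  y = (+ suc j) / 1
  ↥y≡ : ↥ y ≡ + suc j * ↧ y
  ↥y≡ = trans (sym (ℤP.*-identityʳ (↥ y))) (cross-≡ (~-/ (+ suc j) 1))
  y≢0 : y ≢ 0ℚ
  y≢0 y≡0 with trans (sym (cong ↥_ y≡0)) ↥y≡
  ... | ()
  instance
    y-nonZero : ℚ.NonZero y
    y-nonZero = ≢-nonZero y≢0
    ↥y-nonZero : ℤ.NonZero (1ℤ * ↥ y)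
    ↥y-nonZero = ℤ.≢-nonZero λ eq → y≢0 (ℚP.↥p≡0⇒p≡0 y (trans (sym (ℤP.*-identityˡ (↥ y))) eq))
  quotient : (i / 1) ÷ y ~ i / + suc j
  quotient = ~-resize (~-* (~-/ i 1) (~-1/ y))
    (trans (reorder i (↧ y) (+ suc j)) (cong (λ v → i * (1ℤ * v)) (sym ↥y≡)))
    where
    reorder : ∀ a b c → (a * b) * c ≡ a * (1ℤ * (c * b))
    reorder = solve-∀

7ⁿ[7+n]≤7*8ⁿ : ∀ n → 7 ℕ.^ n ℕ.* (7 ℕ.+ n) ≤ 7 ℕ.* 8 ℕ.^ n
7ⁿ[7+n]≤7*8ⁿ zero = ℕP.≤-refl
7ⁿ[7+n]≤7*8ⁿ (suc n) = begin
  7 ℕ.* 7 ℕ.^ n ℕ.* (8 ℕ.+ n)                      ≤⟨ ℕP.m≤m+n _ (7 ℕ.^ n ℕ.* n) ⟩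
  7 ℕ.* 7 ℕ.^ n ℕ.* (8 ℕ.+ n) ℕ.+ 7 ℕ.^ n ℕ.* n    ≡⟨ regroup (7 ℕ.^ n) n ⟩
  8 ℕ.* (7 ℕ.^ n ℕ.* (7 ℕ.+ n))                    ≤⟨ ℕP.*-monoʳ-≤ 8 (7ⁿ[7+n]≤7*8ⁿ n) ⟩
  8 ℕ.* (7 ℕ.* 8 ℕ.^ n)                            ≡⟨ ℕP.*-comm 8 (7 ℕ.* 8 ℕ.^ n) ⟩
  7 ℕ.* 8 ℕ.^ n ℕ.* 8                              ≡⟨ ℕP.*-assoc 7 (8 ℕ.^ n) 8 ⟩
  7 ℕ.* (8 ℕ.^ n ℕ.* 8)                            ≡⟨ cong (7 ℕ.*_) (ℕP.*-comm (8 ℕ.^ n) 8) ⟩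
  7 ℕ.* (8 ℕ.* 8 ℕ.^ n)                            ∎
  where
  open ℕP.≤-Reasoning
  regroup : ∀ x n → 7 ℕ.* x ℕ.* (8 ℕ.+ n) ℕ.+ x ℕ.* n ≡ 8 ℕ.* (x ℕ.* (7 ℕ.+ n))
  regroup = ℕSolver.solve-∀

C*7ⁿ<[1+u]*8ⁿ : ∀ C u n → 7 ℕ.* C ≤ n → C ℕ.* 7 ℕ.^ n < suc u ℕ.* 8 ℕ.^ n
C*7ⁿ<[1+u]*8ⁿ C u n 7C≤n = ℕP.*-cancelˡ-< 7 _ _ (begin-strict
  7 ℕ.* (C ℕ.* 7 ℕ.^ n)   ≡⟨ ℕP.*-assoc 7 C (7 ℕ.^ n) ⟨
  7 ℕ.* C ℕ.* 7 ℕ.^ n     ≤⟨ ℕP.*-monoˡ-≤ (7 ℕ.^ n) 7C≤n ⟩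
  n ℕ.* 7 ℕ.^ n           <⟨ ℕP.*-monoˡ-< (7 ℕ.^ n) {{ℕP.m^n≢0 7 n}} (ℕP.m<n+m n {7} (s≤s z≤n)) ⟩
  (7 ℕ.+ n) ℕ.* 7 ℕ.^ n   ≡⟨ ℕP.*-comm (7 ℕ.+ n) (7 ℕ.^ n) ⟩
  7 ℕ.^ n ℕ.* (7 ℕ.+ n)   ≤⟨ 7ⁿ[7+n]≤7*8ⁿ n ⟩
  7 ℕ.* 8 ℕ.^ n           ≤⟨ ℕP.*-monoʳ-≤ 7 (ℕP.m≤n*m (8 ℕ.^ n) (suc u)) ⟩
  7 ℕ.* (suc u ℕ.* 8 ℕ.^ n) ∎)
  where open ℕP.≤-Reasoning

∣x∣<ε : ∀ {x E d} C n {ε} → 0ℚ ℚ.< ε → x ~ E / d → 0 < ℤ.∣ d ∣ →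
        ℤ.∣ E ∣ ℕ.* 8 ℕ.^ n ≤ C ℕ.* 7 ℕ.^ n ℕ.* ℤ.∣ d ∣ →
        C ℕ.* ℤ.∣ ↧ ε ∣ ℕ.* 7 ℕ.^ n < ℤ.∣ ↥ ε ∣ ℕ.* 8 ℕ.^ n →
        ℚ.∣ x ∣ ℚ.< ε
∣x∣<ε {mkℚ xn xd _} {E} {d} C n {mkℚ +[1+ u ] v _} _ (cross x~E/d) 0<∣d∣ E≤ Cε≤ =
  ℚ.*<* (subst₂ ℤ._<_ (ℤP.pos-* ℤ.∣ xn ∣ (suc v)) (ℤP.pos-* (suc u) (suc xd)) (ℤ.+<+ cross-<))
  where
  X = ℤ.∣ xn ∣
  D = ℤ.∣ d ∣
  ∣x~E/d∣ : X ℕ.* D ≡ ℤ.∣ E ∣ ℕ.* suc xd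
  ∣x~E/d∣ = trans (sym (ℤP.abs-* xn d)) (trans (cong ℤ.∣_∣ x~E/d) (ℤP.abs-* E (+ suc xd)))
  instance
    D*xd≢0 : ℕ.NonZero (D ℕ.* suc xd)
    D*xd≢0 = ℕ.>-nonZero (ℕP.*-mono-< 0<∣d∣ (s≤s z≤n))
  cross-< : X ℕ.* suc v < suc u ℕ.* suc xd
  cross-< = ℕP.*-cancelʳ-< (D ℕ.* 8 ℕ.^ n) _ _ (begin-strict
    X ℕ.* suc v ℕ.* (D ℕ.* 8 ℕ.^ n)               ≡⟨ shuffle₁ X (suc v) D (8 ℕ.^ n) ⟩
    (X ℕ.* D) ℕ.* (suc v ℕ.* 8 ℕ.^ n)             ≡⟨ cong (ℕ._* (suc v ℕ.* 8 ℕ.^ n)) ∣x~E/d∣ ⟩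
    (ℤ.∣ E ∣ ℕ.* suc xd) ℕ.* (suc v ℕ.* 8 ℕ.^ n)  ≡⟨ shuffle₂ ℤ.∣ E ∣ (suc xd) (suc v) (8 ℕ.^ n) ⟩
    (ℤ.∣ E ∣ ℕ.* 8 ℕ.^ n) ℕ.* (suc xd ℕ.* suc v)  ≤⟨ ℕP.*-monoˡ-≤ (suc xd ℕ.* suc v) E≤ ⟩
    (C ℕ.* 7 ℕ.^ n ℕ.* D) ℕ.* (suc xd ℕ.* suc v)  ≡⟨ shuffle₃ C (7 ℕ.^ n) D (suc xd) (suc v) ⟩
    (C ℕ.* suc v ℕ.* 7 ℕ.^ n) ℕ.* (D ℕ.* suc xd)  <⟨ ℕP.*-monoˡ-< (D ℕ.* suc xd) Cε≤ ⟩
    (suc u ℕ.* 8 ℕ.^ n) ℕ.* (D ℕ.* suc xd)        ≡⟨ shuffle₄ (suc u) (8 ℕ.^ n) D (suc xd) ⟩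
    suc u ℕ.* suc xd ℕ.* (D ℕ.* 8 ℕ.^ n)          ∎)
    where
    open ℕP.≤-Reasoning
    shuffle₁ : ∀ a b c d → a ℕ.* b ℕ.* (c ℕ.* d) ≡ (a ℕ.* c) ℕ.* (b ℕ.* d)
    shuffle₁ = ℕSolver.solve-∀
    shuffle₂ : ∀ a b c d → (a ℕ.* b) ℕ.* (c ℕ.* d) ≡ (a ℕ.* d) ℕ.* (b ℕ.* c)
    shuffle₂ = ℕSolver.solve-∀
    shuffle₃ : ∀ a b c d e → (a ℕ.* b ℕ.* c) ℕ.* (d ℕ.* e) ≡ (a ℕ.* e ℕ.* b) ℕ.* (c ℕ.* d)
    shuffle₃ = ℕSolver.solve-∀
    shuffle₄ : ∀ a b c d → (a ℕ.* b) ℕ.* (c ℕ.* d) ≡ a ℕ.* d ℕ.* (c ℕ.* b)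
    shuffle₄ = ℕSolver.solve-∀
∣x∣<ε C n {mkℚ +0 _ _} (ℚ.*<* (ℤ.+<+ ()))
∣x∣<ε C n {mkℚ -[1+ _ ] _ _} (ℚ.*<* ())

sumsTo-of-error-bound : ∀ (a : ℕ → ℚ) S (e d : ℕ → ℤ) C →
  (∀ n → partialSum a n ℚ.- S ~ e n / d n) → (∀ n → 0 < ℤ.∣ d n ∣) →
  (∀ n → ℤ.∣ e n ∣ ℕ.* 8 ℕ.^ n ≤ C ℕ.* 7 ℕ.^ n ℕ.* ℤ.∣ d n ∣) →
  SeriesSumsTo a S
sumsTo-of-error-bound a S e d C error 0<∣d∣ e≤ ε@(mkℚ +[1+ u ] v _) 0<ε =
  7 ℕ.* C′ , λ n 7C′≤n →
    ∣x∣<ε C n 0<ε (error n) (0<∣d∣ n) (e≤ n) (C*7ⁿ<[1+u]*8ⁿ C′ u n 7C′≤n)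
  where C′ = C ℕ.* suc v
sumsTo-of-error-bound a S e d C error 0<∣d∣ e≤ (mkℚ +0 _ _) (ℚ.*<* (ℤ.+<+ ()))
sumsTo-of-error-bound a S e d C error 0<∣d∣ e≤ (mkℚ -[1+ _ ] _ _) (ℚ.*<* ())

growthBound : (ℕ → ℤ) → ℕ
growthBound b = ℤ.∣ b 0 ∣ ℕ.+ 4 ℕ.* ℤ.∣ b 1 ∣

-- 7/4 exceeds the golden ratio, so (7/4)^i dominates any recurrent sequence.
recurrent-bound : ∀ b → Recurrent b → ∀ i →
                  ℤ.∣ b i ∣ ℕ.* 4 ℕ.^ i ≤ growthBound b ℕ.* 7 ℕ.^ i
recurrent-bound b rec i = proj₁ (consecutive i)
  where
  M = growthBound b
  Bounded : ℕ → Set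
  Bounded i = ℤ.∣ b i ∣ ℕ.* 4 ℕ.^ i ≤ M ℕ.* 7 ℕ.^ i
  consecutive : ∀ i → Bounded i × Bounded (suc i)
  consecutive zero = ℕP.*-monoˡ-≤ 1 (ℕP.m≤m+n ℤ.∣ b 0 ∣ _) , (begin
    ℤ.∣ b 1 ∣ ℕ.* (4 ℕ.* 1)  ≡⟨ ℕP.*-comm ℤ.∣ b 1 ∣ 4 ⟩
    4 ℕ.* ℤ.∣ b 1 ∣          ≤⟨ ℕP.m≤n+m (4 ℕ.* ℤ.∣ b 1 ∣) ℤ.∣ b 0 ∣ ⟩
    M                         ≤⟨ ℕP.m≤m*n M 7 ⟩
    M ℕ.* 7                   ∎)
    where open ℕP.≤-Reasoning
  consecutive (suc i) = proj₂ (consecutive i) , (begin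
    ℤ.∣ b (suc (suc i)) ∣ ℕ.* (4 ℕ.* (4 ℕ.* 4ⁱ))
      ≤⟨ ℕP.*-monoˡ-≤ (4 ℕ.* (4 ℕ.* 4ⁱ)) ∣b₂∣≤∣b₁∣+∣b₀∣ ⟩
    (x ℕ.+ y) ℕ.* (4 ℕ.* (4 ℕ.* 4ⁱ))
      ≡⟨ expand x y 4ⁱ ⟩
    4 ℕ.* (x ℕ.* (4 ℕ.* 4ⁱ)) ℕ.+ 16 ℕ.* (y ℕ.* 4ⁱ)
      ≤⟨ ℕP.+-mono-≤ (ℕP.*-monoʳ-≤ 4 (proj₂ (consecutive i))) (ℕP.*-monoʳ-≤ 16 (proj₁ (consecutive i))) ⟩
    4 ℕ.* (M ℕ.* (7 ℕ.* 7ⁱ)) ℕ.+ 16 ℕ.* (M ℕ.* 7ⁱ)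
      ≤⟨ ℕP.m≤m+n _ (5 ℕ.* (M ℕ.* 7ⁱ)) ⟩
    4 ℕ.* (M ℕ.* (7 ℕ.* 7ⁱ)) ℕ.+ 16 ℕ.* (M ℕ.* 7ⁱ) ℕ.+ 5 ℕ.* (M ℕ.* 7ⁱ)
      ≡⟨ collect M 7ⁱ ⟩
    M ℕ.* (7 ℕ.* (7 ℕ.* 7ⁱ)) ∎)
    where
    open ℕP.≤-Reasoning
    x = ℤ.∣ b (suc i) ∣
    y = ℤ.∣ b i ∣
    4ⁱ = 4 ℕ.^ i
    7ⁱ = 7 ℕ.^ i
    ∣b₂∣≤∣b₁∣+∣b₀∣ : ℤ.∣ b (suc (suc i)) ∣ ≤ x ℕ.+ y
    ∣b₂∣≤∣b₁∣+∣b₀∣ = subst (λ v → ℤ.∣ v ∣ ≤ x ℕ.+ y) (sym (rec i)) (ℤP.∣i+j∣≤∣i∣+∣j∣ (b (suc i)) (b i))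
    expand : ∀ x y z → (x ℕ.+ y) ℕ.* (4 ℕ.* (4 ℕ.* z)) ≡ 4 ℕ.* (x ℕ.* (4 ℕ.* z)) ℕ.+ 16 ℕ.* (y ℕ.* z)
    expand = ℕSolver.solve-∀
    collect : ∀ M z → 4 ℕ.* (M ℕ.* (7 ℕ.* z)) ℕ.+ 16 ℕ.* (M ℕ.* z) ℕ.+ 5 ℕ.* (M ℕ.* z) ≡ M ℕ.* (7 ℕ.* (7 ℕ.* z))
    collect = ℕSolver.solve-∀

recurrent-bound-≤ : ∀ b → Recurrent b → ∀ {i j} → i ≤ j →
                    ℤ.∣ b i ∣ ℕ.* 4 ℕ.^ j ≤ growthBound b ℕ.* 7 ℕ.^ j
recurrent-bound-≤ b rec {i} {j} i≤j =
  subst (λ j → ℤ.∣ b i ∣ ℕ.* 4 ℕ.^ j ≤ M ℕ.* 7 ℕ.^ j) (ℕP.m+[n∸m]≡n i≤j) (begin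
    ℤ.∣ b i ∣ ℕ.* 4 ℕ.^ (i ℕ.+ d)        ≡⟨ cong (ℤ.∣ b i ∣ ℕ.*_) (ℕP.^-distribˡ-+-* 4 i d) ⟩
    ℤ.∣ b i ∣ ℕ.* (4 ℕ.^ i ℕ.* 4 ℕ.^ d)   ≡⟨ ℕP.*-assoc ℤ.∣ b i ∣ _ _ ⟨
    ℤ.∣ b i ∣ ℕ.* 4 ℕ.^ i ℕ.* 4 ℕ.^ d     ≤⟨ ℕP.*-mono-≤ (recurrent-bound b rec i) (ℕP.^-monoˡ-≤ d 4≤7) ⟩
    M ℕ.* 7 ℕ.^ i ℕ.* 7 ℕ.^ d             ≡⟨ ℕP.*-assoc M _ _ ⟩
    M ℕ.* (7 ℕ.^ i ℕ.* 7 ℕ.^ d)           ≡⟨ cong (M ℕ.*_) (ℕP.^-distribˡ-+-* 7 i d) ⟨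
    M ℕ.* 7 ℕ.^ (i ℕ.+ d)                 ∎)
  where
  open ℕP.≤-Reasoning
  M = growthBound b
  d = j ℕ.∸ i
  4≤7 : 4 ≤ 7
  4≤7 = ℕP.m≤m+n 4 3

8ⁿ≡4ⁿ*2ⁿ : ∀ n → 8 ℕ.^ n ≡ 4 ℕ.^ n ℕ.* 2 ℕ.^ n
8ⁿ≡4ⁿ*2ⁿ zero = refl
8ⁿ≡4ⁿ*2ⁿ (suc n) = trans (cong (8 ℕ.*_) (8ⁿ≡4ⁿ*2ⁿ n)) (interchange (4 ℕ.^ n) (2 ℕ.^ n))
  where
  interchange : ∀ x y → 8 ℕ.* (x ℕ.* y) ≡ 4 ℕ.* x ℕ.* (2 ℕ.* y)
  interchange = ℕSolver.solve-∀

∣linear₃∣-bound : ∀ c₁ c₂ c₃ x₁ x₂ x₃ {C₃ u v M} → ℤ.∣ c₃ ∣ ≤ C₃ →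
  ℤ.∣ x₁ ∣ ℕ.* u ≤ M ℕ.* v → ℤ.∣ x₂ ∣ ℕ.* u ≤ M ℕ.* v → ℤ.∣ x₃ ∣ ℕ.* u ≤ M ℕ.* v →
  ℤ.∣ c₁ * x₁ + c₂ * x₂ + c₃ * x₃ ∣ ℕ.* u ≤ (ℤ.∣ c₁ ∣ ℕ.+ ℤ.∣ c₂ ∣ ℕ.+ C₃) ℕ.* M ℕ.* v
∣linear₃∣-bound c₁ c₂ c₃ x₁ x₂ x₃ {C₃} {u} {v} {M} c₃≤ x₁≤ x₂≤ x₃≤ = begin
  ℤ.∣ c₁ * x₁ + c₂ * x₂ + c₃ * x₃ ∣ ℕ.* u
    ≤⟨ ℕP.*-monoˡ-≤ u triangle ⟩
  (a₁ ℕ.* ℤ.∣ x₁ ∣ ℕ.+ a₂ ℕ.* ℤ.∣ x₂ ∣ ℕ.+ a₃ ℕ.* ℤ.∣ x₃ ∣) ℕ.* u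
    ≡⟨ distribute a₁ a₂ a₃ ℤ.∣ x₁ ∣ ℤ.∣ x₂ ∣ ℤ.∣ x₃ ∣ u ⟩
  a₁ ℕ.* (ℤ.∣ x₁ ∣ ℕ.* u) ℕ.+ a₂ ℕ.* (ℤ.∣ x₂ ∣ ℕ.* u) ℕ.+ a₃ ℕ.* (ℤ.∣ x₃ ∣ ℕ.* u)
    ≤⟨ ℕP.+-mono-≤ (ℕP.+-mono-≤ (ℕP.*-monoʳ-≤ a₁ x₁≤) (ℕP.*-monoʳ-≤ a₂ x₂≤)) (ℕP.*-mono-≤ c₃≤ x₃≤) ⟩
  a₁ ℕ.* (M ℕ.* v) ℕ.+ a₂ ℕ.* (M ℕ.* v) ℕ.+ C₃ ℕ.* (M ℕ.* v)
    ≡⟨ collect a₁ a₂ C₃ M v ⟩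
  (a₁ ℕ.+ a₂ ℕ.+ C₃) ℕ.* M ℕ.* v ∎
  where
  open ℕP.≤-Reasoning
  a₁ = ℤ.∣ c₁ ∣
  a₂ = ℤ.∣ c₂ ∣
  a₃ = ℤ.∣ c₃ ∣
  triangle : ℤ.∣ c₁ * x₁ + c₂ * x₂ + c₃ * x₃ ∣ ≤ a₁ ℕ.* ℤ.∣ x₁ ∣ ℕ.+ a₂ ℕ.* ℤ.∣ x₂ ∣ ℕ.+ a₃ ℕ.* ℤ.∣ x₃ ∣
  triangle = ℕP.≤-trans (ℤP.∣i+j∣≤∣i∣+∣j∣ (c₁ * x₁ + c₂ * x₂) (c₃ * x₃))
    (ℕP.+-mono-≤ (ℕP.≤-trans (ℤP.∣i+j∣≤∣i∣+∣j∣ (c₁ * x₁) (c₂ * x₂))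
                             (ℕP.≤-reflexive (cong₂ ℕ._+_ (ℤP.abs-* c₁ x₁) (ℤP.abs-* c₂ x₂))))
                 (ℕP.≤-reflexive (ℤP.abs-* c₃ x₃)))
  distribute : ∀ a₁ a₂ a₃ x₁ x₂ x₃ u → (a₁ ℕ.* x₁ ℕ.+ a₂ ℕ.* x₂ ℕ.+ a₃ ℕ.* x₃) ℕ.* u
               ≡ a₁ ℕ.* (x₁ ℕ.* u) ℕ.+ a₂ ℕ.* (x₂ ℕ.* u) ℕ.+ a₃ ℕ.* (x₃ ℕ.* u)
  distribute = ℕSolver.solve-∀
  collect : ∀ a₁ a₂ a₃ M v → a₁ ℕ.* (M ℕ.* v) ℕ.+ a₂ ℕ.* (M ℕ.* v) ℕ.+ a₃ ℕ.* (M ℕ.* v)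
            ≡ (a₁ ℕ.+ a₂ ℕ.+ a₃) ℕ.* M ℕ.* v
  collect = ℕSolver.solve-∀

+-^ : ∀ p n → (+ p) ^ n ≡ + (p ℕ.^ n)
+-^ p zero = refl
+-^ p (suc n) = trans (cong (+ p *_) (+-^ p n)) (sym (ℤP.pos-* p (p ℕ.^ n)))

lucℕ-positive : ∀ n → ∃ λ l → lucℕ n ≡ +[1+ l ]
lucℕ-positive 0 = 1 , refl
lucℕ-positive 1 = 0 , refl
lucℕ-positive (suc (suc n)) with lucℕ-positive (suc n) | lucℕ-positive n
... | l₁ , eq₁ | l₀ , eq₀ = l₁ ℕ.+ suc l₀ , cong₂ _+_ eq₁ eq₀

[qk+r]/k≡q : ∀ q k r .{{_ : NonZero k}} → r < k → (q ℕ.* k ℕ.+ r) ℕDiv./ k ≡ q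
[qk+r]/k≡q q k r r<k = begin
  (q ℕ.* k ℕ.+ r) ℕDiv./ k               ≡⟨ ℕDiv.+-distrib-/-∣ˡ r (n∣m*n q) ⟩
  q ℕ.* k ℕDiv./ k ℕ.+ r ℕDiv./ k       ≡⟨ cong₂ ℕ._+_ (ℕDiv.m*n/n≡m q k) (ℕDiv.m<n⇒m/n≡0 r<k) ⟩
  q ℕ.+ 0                                ≡⟨ ℕP.+-identityʳ q ⟩
  q                                      ∎
  where open ≡-Reasoning

x+y-z≡x-z+y : ∀ x y z → x ℚ.+ y ℚ.- z ≡ x ℚ.- z ℚ.+ y
x+y-z≡x-z+y x y z = begin
  x ℚ.+ y ℚ.- z          ≡⟨ ℚP.+-assoc x y (ℚ.- z) ⟩
  x ℚ.+ (y ℚ.- z)        ≡⟨ cong (x ℚ.+_) (ℚP.+-comm y (ℚ.- z)) ⟩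
  x ℚ.+ (ℚ.- z ℚ.+ y)    ≡⟨ ℚP.+-assoc x (ℚ.- z) y ⟨
  x ℚ.- z ℚ.+ y          ∎
  where open ≡-Reasoning

module BlockSignedSeries (k₀ p₀ : ℕ) (X : ℤ → ℤ)
                         (X-rec : ∀ z → X (z + + 2) ≡ X (z + + 1) + X z) (m : ℤ) where

  k p : ℕ
  k = suc k₀
  p = suc (suc p₀)

  p̂ : ℤ
  p̂ = + p

  c : ℤ
  c = m - + k - + 1

  -- Shifted so that the n-th term of the series involves X (n + m) = a (n + k + 1).
  a : ℕ → ℤ
  a i = X (c + + i)

  a-rec : Recurrent a
  a-rec i = trans (cong X (shift 2)) (trans (X-rec _) (cong (λ z → X z + a i) (sym (shift 1))))
    where
    shift : ∀ j → c + + (j ℕ.+ i) ≡ (c + + i) + + j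
    shift j = trans (cong (λ w → c + w) (ℤP.pos-+ j i)) (swap c (+ i) (+ j))
      where
      swap : ∀ z x y → z + (y + x) ≡ (z + x) + y
      swap = solve-∀

  b : ℕ → ℤ
  b i = p̂ * a (suc i) + a i

  b-rec : Recurrent b
  b-rec i = trans (cong₂ (λ u v → p̂ * u + v) (a-rec (suc i)) (a-rec i))
                  (regroup p̂ (a (suc (suc i))) (a (suc i)) (a i))
    where
    regroup : ∀ q x y z → q * (x + y) + (y + z) ≡ (q * x + y) + (q * y + z)
    regroup = solve-∀

  P Lₖ σ : ℤ
  P = p̂ ^ k
  Lₖ = lucℕ k
  σ = sgn k

  Z : ℕ → ℤ
  Z j = b (j ℕ.* k)

  Z-rec : ∀ j → Z (suc (suc j)) ≡ Lₖ * Z (suc j) - σ * Z j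
  Z-rec j = recurrent-step b b-rec k (j ℕ.* k)

  D Den Num : ℤ
  D = P * P + P * Lₖ + σ
  Den = (p̂ * p̂ - p̂ - + 1) * D
  Num = (P * P - σ) * Z 1 - P * Z 2 + σ * P * Z 0

  S : ℚ
  S = (Num / 1) ÷₀ (Den / 1)

  G : ℕ → ℚ
  G = partialSum (term X k p m)

  den : ℕ → ℤ
  den q = Den * P ^ suc q

  c₁ c₂ : ℤ
  c₁ = - (+ 2 * P * (P + Lₖ))
  c₂ = + 2 * P

  -- e q r t / den q is the remainder S - G (q k + r), where r + t = k: the last summand is
  -- the telescoped rest of block q, the other two the sum of all later blocks.

  e : ℕ → ℕ → ℕ → ℤ
  e q r t = sgn q * (c₁ * Z (suc (suc q)) + c₂ * Z (suc (suc (suc q))) + D * p̂ ^ t * b (q ℕ.* k ℕ.+ r ℕ.+ k))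

  p̂^n≡+[1+] : ∀ n → p̂ ^ n ≡ +[1+ ℕ.pred (p ℕ.^ n) ]
  p̂^n≡+[1+] n = trans (+-^ p n) (cong +_ (sym (ℕP.suc-pred (p ℕ.^ n) {{ℕP.m^n≢0 p n}})))

  P^n-nonZero : ∀ n → ℤ.NonZero (P ^ n)
  P^n-nonZero n = subst ℤ.NonZero (sym (trans (ℤP.^-*-assoc p̂ k n) (p̂^n≡+[1+] (k ℕ.* n)))) _

  P*P+P*Lₖ≥2 : ∃ λ w → P * P + P * Lₖ ≡ + suc (suc w)
  P*P+P*Lₖ≥2 with lucℕ-positive k
  ... | l , Lₖ≡ = π ℕ.+ l ℕ.+ π ℕ.* suc (π ℕ.+ suc l) , (begin
    P * P + P * Lₖ                     ≡⟨ factor P Lₖ ⟩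
    P * (P + Lₖ)                       ≡⟨ cong₂ (λ u v → u * (u + v)) (p̂^n≡+[1+] k) Lₖ≡ ⟩
    +[1+ π ] * (+[1+ π ] + +[1+ l ])   ≡⟨ cong (λ x → + suc (x ℕ.+ π ℕ.* suc (π ℕ.+ suc l))) (ℕP.+-suc π l) ⟩
    + suc (suc (π ℕ.+ l ℕ.+ π ℕ.* suc (π ℕ.+ suc l))) ∎)
    where
    open ≡-Reasoning
    π = ℕ.pred (p ℕ.^ k)
    factor : ∀ x y → x * x + x * y ≡ x * (x + y)
    factor = solve-∀

  D-positive : ∃ λ j → D ≡ +[1+ j ]
  D-positive with P*P+P*Lₖ≥2 | sgn≡1⊎sgn≡-1 k
  ... | w , eq | inj₁ σ≡1 = suc w ℕ.+ 1 , cong₂ _+_ eq σ≡1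
  ... | w , eq | inj₂ σ≡-1 = w , cong₂ _+_ eq σ≡-1

  Den-positive : ∃ λ j → Den ≡ +[1+ j ]
  Den-positive with D-positive
  ... | j , D≡ = _ , cong₂ _*_ p²-p-1≡ D≡
    where
    p²-p-1≡ : p̂ * p̂ - p̂ - + 1 ≡ +[1+ p₀ ℕ.* p₀ ℕ.+ 3 ℕ.* p₀ ]
    p²-p-1≡ = begin
      p̂ * p̂ - p̂ - + 1                           ≡⟨ cong (λ v → v * v - v - + 1) (ℤP.pos-+ 2 p₀) ⟩
      (+ 2 + + p₀) * (+ 2 + + p₀) - (+ 2 + + p₀) - + 1 ≡⟨ expand (+ p₀) ⟩
      + 1 + (+ p₀ * + p₀ + + 3 * + p₀)           ≡⟨ cong (λ v → + 1 + v) (cong₂ _+_ (ℤP.pos-* p₀ p₀) (ℤP.pos-* 3 p₀)) ⟨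
      + 1 + (+ (p₀ ℕ.* p₀) + + (3 ℕ.* p₀))        ≡⟨ cong (λ v → + 1 + v) (ℤP.pos-+ (p₀ ℕ.* p₀) (3 ℕ.* p₀)) ⟨
      +[1+ p₀ ℕ.* p₀ ℕ.+ 3 ℕ.* p₀ ]               ∎
      where
      open ≡-Reasoning
      expand : ∀ x → (+ 2 + x) * (+ 2 + x) - (+ 2 + x) - + 1 ≡ + 1 + (x * x + + 3 * x)
      expand = solve-∀

  instance
    Den-nonZero : ℤ.NonZero Den
    Den-nonZero = subst ℤ.NonZero (sym (proj₂ Den-positive)) _

  den-nonZero : ∀ q → ℤ.NonZero (den q)
  den-nonZero q = ℤP.i*j≢0 Den (P ^ suc q) {{Den-nonZero}} {{P^n-nonZero (suc q)}}

  p̂^n-nonZero : ∀ n → ℤ.NonZero (p̂ ^ n)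
  p̂^n-nonZero n = subst ℤ.NonZero (sym (p̂^n≡+[1+] n)) _

  S~Num/Den : S ~ Num / Den
  S~Num/Den with Den-positive
  ... | j , Den≡ = subst (λ d → (Num / 1) ÷₀ (d / 1) ~ Num / d) (sym Den≡) (~-÷₀ Num j)

  term~ : ∀ q r → r < k → let n = q ℕ.* k ℕ.+ r in
          term X k p m n ~ sgn q * a (suc (n ℕ.+ k)) / p̂ ^ suc n
  term~ q r r<k =
    subst (λ v → term X k p m n ~ v / p̂ ^ suc n)
          (cong₂ _*_ (cong sgn ([qk+r]/k≡q q k r r<k)) (cong X index)) quotient
    where
    n = q ℕ.* k ℕ.+ r
    num = sgn (n ℕDiv./ k) * X (+ n + m)
    quotient : term X k p m n ~ num / p̂ ^ suc n
    quotient = subst (λ d → (num / 1) ÷₀ (d / 1) ~ num / d) (sym (p̂^n≡+[1+] (suc n))) (~-÷₀ num _)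
    index : + n + m ≡ c + + suc (n ℕ.+ k)
    index = trans (regroup m (+ n) (+ k)) (cong (λ w → c + (+ 1 + w)) (sym (ℤP.pos-+ n k)))
      where
      regroup : ∀ m n k → n + m ≡ (m - k - + 1) + (+ 1 + (n + k))
      regroup = solve-∀

  Remainder : ℕ → ℕ → ℕ → Set
  Remainder q r t = G (q ℕ.* k ℕ.+ r) ℚ.- S ~ - e q r t / den q

  e₀≡Num*P : e 0 0 k ≡ Num * P
  e₀≡Num*P = identity P Lₖ σ (Z 0) (Z 1) (Z 2) (Z 3) (b k)
                      (cong b (ℕP.+-identityʳ k)) (Z-rec 0) (Z-rec 1)
    where
    polynomial : ∀ P L σ Z₀ Z₁ →
      1ℤ * (- (+ 2 * P * (P + L)) * (L * Z₁ - σ * Z₀) + + 2 * P * (L * (L * Z₁ - σ * Z₀) - σ * Z₁)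
            + (P * P + P * L + σ) * P * Z₁)
      ≡ ((P * P - σ) * Z₁ - P * (L * Z₁ - σ * Z₀) + σ * P * Z₀) * P
    polynomial = solve-∀
    identity : ∀ P L σ Z₀ Z₁ Z₂ Z₃ B → Z₁ ≡ B → Z₂ ≡ L * Z₁ - σ * Z₀ → Z₃ ≡ L * Z₂ - σ * Z₁ →
      1ℤ * (- (+ 2 * P * (P + L)) * Z₂ + + 2 * P * Z₃ + (P * P + P * L + σ) * P * B)
      ≡ ((P * P - σ) * Z₁ - P * Z₂ + σ * P * Z₀) * P
    identity P L σ Z₀ Z₁ _ _ _ refl refl refl = polynomial P L σ Z₀ Z₁

  remainder-start : Remainder 0 0 k
  remainder-start = ~-resize (~-cong (sym (ℚP.+-identityˡ (ℚ.- S))) (~-neg S~Num/Den))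
    (trans (identity Num Den P) (cong (λ v → - v * Den) (sym e₀≡Num*P)))
    where
    identity : ∀ N D P → - N * (D * (P * 1ℤ)) ≡ - (N * P) * D
    identity = solve-∀

  -- Within a block the terms telescope, since (p² - p - 1) a (i+1) = p b i - b (i+1).
  remainder-step : ∀ q r t → r ℕ.+ suc t ≡ k → Remainder q r (suc t) → Remainder q (suc r) t
  remainder-step q r t r+[1+t]≡k rem =
    subst (λ j → G j ℚ.- S ~ - e q (suc r) t / den q) (sym (ℕP.+-suc (q ℕ.* k) r))
      (~-resize {{ℤP.i*j≢0 (den q) W {{den-nonZero q}} {{p̂^n-nonZero (suc n)}}}}
        (~-cong (sym (x+y-z≡x-z+y (G n) (term X k p m n) S)) (~-+ rem (term~ q r r<k)))
        (combine (e q r (suc t)) (e q (suc r) t) T W (den q) T*den≡))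
    where
    n = q ℕ.* k ℕ.+ r
    r<k : r < k
    r<k = subst (r <_) r+[1+t]≡k (ℕP.m<m+n r (s≤s z≤n))
    W = p̂ ^ suc n
    A₀ = a (n ℕ.+ k)
    A₁ = a (suc (n ℕ.+ k))
    T = sgn q * A₁
    P^q≡W*p̂ᵗ : P ^ suc q ≡ W * p̂ ^ t
    P^q≡W*p̂ᵗ = trans (ℤP.^-*-assoc p̂ k (suc q))
                 (trans (cong (p̂ ^_) (subst (λ k → k ℕ.* suc q ≡ suc (q ℕ.* k ℕ.+ r) ℕ.+ t) r+[1+t]≡k (exponent q r t)))
                        (ℤP.^-distribˡ-+-* p̂ (suc n) t))
      where
      exponent : ∀ q r t → (r ℕ.+ suc t) ℕ.* suc q ≡ suc (q ℕ.* (r ℕ.+ suc t) ℕ.+ r) ℕ.+ t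
      exponent = ℕSolver.solve-∀
    b-next : b (q ℕ.* k ℕ.+ suc r ℕ.+ k) ≡ p̂ * (A₁ + A₀) + A₁
    b-next = trans (cong (λ j → b (j ℕ.+ k)) (ℕP.+-suc (q ℕ.* k) r)) (cong (λ v → p̂ * v + A₁) (a-rec (n ℕ.+ k)))
    K = c₁ * Z (suc (suc q)) + c₂ * Z (suc (suc (suc q)))
    polynomial : ∀ s A₀ A₁ p D W U K → s * A₁ * ((p * p - p - + 1) * D * (W * U)) ≡
      (s * (K + D * (p * U) * (p * A₁ + A₀)) - s * (K + D * U * (p * (A₁ + A₀) + A₁))) * W
    polynomial = solve-∀
    T*den≡ : T * den q ≡ (e q r (suc t) - e q (suc r) t) * W
    T*den≡ = begin
      T * (Den * P ^ suc q)
        ≡⟨ cong (λ v → T * (Den * v)) P^q≡W*p̂ᵗ ⟩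
      T * (Den * (W * p̂ ^ t))
        ≡⟨ polynomial (sgn q) A₀ A₁ p̂ D W (p̂ ^ t) K ⟩
      (sgn q * (K + D * p̂ ^ suc t * (p̂ * A₁ + A₀)) - sgn q * (K + D * p̂ ^ t * (p̂ * (A₁ + A₀) + A₁))) * W
        ≡⟨ cong (λ v → (sgn q * (K + D * p̂ ^ suc t * (p̂ * A₁ + A₀)) - sgn q * (K + D * p̂ ^ t * v)) * W) b-next ⟨
      (e q r (suc t) - e q (suc r) t) * W ∎
      where open ≡-Reasoning
    combine : ∀ e e′ T W d → T * d ≡ (e - e′) * W → (- e * W + T * d) * d ≡ - e′ * (d * W)
    combine e e′ T W d T*d≡ = trans (cong (λ v → (- e * W + v) * d) T*d≡) (polynomial′ e e′ W d)
      where
      polynomial′ : ∀ e e′ W d → (- e * W + (e - e′) * W) * d ≡ - e′ * (d * W)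
      polynomial′ = solve-∀

  e-next-block : ∀ q → e q k 0 * P ≡ e (suc q) 0 k
  e-next-block q = identity (sgn q) P Lₖ σ (Z (suc (suc q))) (Z (suc (suc (suc q)))) (Z (suc (suc (suc (suc q)))))
                            _ _ (cong b (index₁ q k)) (cong b (index₂ q k)) (Z-rec (suc (suc q)))
    where
    index₁ : ∀ q k → q ℕ.* k ℕ.+ k ℕ.+ k ≡ k ℕ.+ (k ℕ.+ q ℕ.* k)
    index₁ = ℕSolver.solve-∀
    index₂ : ∀ q k → k ℕ.+ q ℕ.* k ℕ.+ 0 ℕ.+ k ≡ k ℕ.+ (k ℕ.+ q ℕ.* k)
    index₂ = ℕSolver.solve-∀
    polynomial : ∀ s P L σ Z₂ Z₃ →
      s * (- (+ 2 * P * (P + L)) * Z₂ + + 2 * P * Z₃ + (P * P + P * L + σ) * 1ℤ * Z₂) * P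
      ≡ - 1ℤ * s * (- (+ 2 * P * (P + L)) * Z₃ + + 2 * P * (L * Z₃ - σ * Z₂) + (P * P + P * L + σ) * P * Z₂)
    polynomial = solve-∀
    identity : ∀ s P L σ Z₂ Z₃ Z₄ B B′ → B ≡ Z₂ → B′ ≡ Z₂ → Z₄ ≡ L * Z₃ - σ * Z₂ →
      s * (- (+ 2 * P * (P + L)) * Z₂ + + 2 * P * Z₃ + (P * P + P * L + σ) * 1ℤ * B) * P
      ≡ - 1ℤ * s * (- (+ 2 * P * (P + L)) * Z₃ + + 2 * P * Z₄ + (P * P + P * L + σ) * P * B′)
    identity s P L σ Z₂ Z₃ _ _ _ refl refl refl = polynomial s P L σ Z₂ Z₃

  remainder-next-block : ∀ q → Remainder q k 0 → Remainder (suc q) 0 k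
  remainder-next-block q rem =
    ~-cong (cong (λ j → G j ℚ.- S) (index q k))
      (~-resize {{den-nonZero q}} rem
        (trans (identity (e q k 0) Den P (P ^ suc q)) (cong (λ v → - v * den q) (e-next-block q))))
    where
    index : ∀ q k → q ℕ.* k ℕ.+ k ≡ suc q ℕ.* k ℕ.+ 0
    index = ℕSolver.solve-∀
    identity : ∀ e D P Pq → - e * (D * (P * Pq)) ≡ - (e * P) * (D * Pq)
    identity = solve-∀

  remainder-in-block : ∀ q → Remainder q 0 k → ∀ r t → r ℕ.+ t ≡ k → Remainder q r t
  remainder-in-block q rem zero t t≡k = subst (Remainder q 0) (sym t≡k) rem
  remainder-in-block q rem (suc r) t [1+r]+t≡k =
    remainder-step q r t r+[1+t]≡k (remainder-in-block q rem r (suc t) r+[1+t]≡k)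
    where r+[1+t]≡k = trans (ℕP.+-suc r t) [1+r]+t≡k

  remainder-block-start : ∀ q → Remainder q 0 k
  remainder-block-start zero = remainder-start
  remainder-block-start (suc q) =
    remainder-next-block q (remainder-in-block q (remainder-block-start q) k 0 (ℕP.+-identityʳ k))

  A C : ℕ
  A = ℤ.∣ c₁ ∣ ℕ.+ ℤ.∣ c₂ ∣ ℕ.+ ℤ.∣ D ∣ ℕ.* p ℕ.^ k
  C = A ℕ.* growthBound b ℕ.* 7 ℕ.^ (k ℕ.+ (k ℕ.+ k))

  ∣e∣*4ⁿ≤C*7ⁿ : ∀ q r t → t ≤ k → let n = q ℕ.* k ℕ.+ r in
                ℤ.∣ e q r t ∣ ℕ.* 4 ℕ.^ n ≤ C ℕ.* 7 ℕ.^ n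
  ∣e∣*4ⁿ≤C*7ⁿ q r t t≤k = begin
    ℤ.∣ e q r t ∣ ℕ.* 4 ℕ.^ n
      ≤⟨ ℕP.m≤m*n _ (4 ℕ.^ 3k) {{ℕP.m^n≢0 4 3k}} ⟩
    ℤ.∣ e q r t ∣ ℕ.* 4 ℕ.^ n ℕ.* 4 ℕ.^ 3k
      ≡⟨ trans (ℕP.*-assoc ℤ.∣ e q r t ∣ _ _) (cong (ℤ.∣ e q r t ∣ ℕ.*_) (sym (ℕP.^-distribˡ-+-* 4 n 3k))) ⟩
    ℤ.∣ e q r t ∣ ℕ.* 4 ℕ.^ I
      ≡⟨ cong (ℕ._* 4 ℕ.^ I) (trans (ℤP.abs-* (sgn q) Y) (trans (cong (ℕ._* ℤ.∣ Y ∣) (∣sgn∣≡1 q)) (ℕP.*-identityˡ ℤ.∣ Y ∣))) ⟩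
    ℤ.∣ Y ∣ ℕ.* 4 ℕ.^ I
      ≤⟨ ∣linear₃∣-bound c₁ c₂ (D * p̂ ^ t) (Z (suc (suc q))) (Z (suc (suc (suc q)))) (b (n ℕ.+ k)) ∣D*p̂ᵗ∣≤
           (recurrent-bound-≤ b b-rec index₂) (recurrent-bound-≤ b b-rec index₃) (recurrent-bound-≤ b b-rec indexₙ) ⟩
    A ℕ.* growthBound b ℕ.* 7 ℕ.^ I
      ≡⟨ trans (cong (A ℕ.* growthBound b ℕ.*_) (ℕP.^-distribˡ-+-* 7 n 3k)) (swap (A ℕ.* growthBound b) (7 ℕ.^ n) (7 ℕ.^ 3k)) ⟩
    C ℕ.* 7 ℕ.^ n ∎
    where
    open ℕP.≤-Reasoning
    n = q ℕ.* k ℕ.+ r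
    3k = k ℕ.+ (k ℕ.+ k)
    I = n ℕ.+ 3k
    Y = c₁ * Z (suc (suc q)) + c₂ * Z (suc (suc (suc q))) + D * p̂ ^ t * b (n ℕ.+ k)
    ∣D*p̂ᵗ∣≤ : ℤ.∣ D * p̂ ^ t ∣ ≤ ℤ.∣ D ∣ ℕ.* p ℕ.^ k
    ∣D*p̂ᵗ∣≤ = subst (_≤ ℤ.∣ D ∣ ℕ.* p ℕ.^ k)
                (sym (trans (ℤP.abs-* D (p̂ ^ t)) (cong (λ v → ℤ.∣ D ∣ ℕ.* ℤ.∣ v ∣) (+-^ p t))))
                (ℕP.*-monoʳ-≤ ℤ.∣ D ∣ (ℕP.^-monoʳ-≤ p t≤k))
    index₂ : k ℕ.+ (k ℕ.+ q ℕ.* k) ≤ I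
    index₂ = subst (k ℕ.+ (k ℕ.+ q ℕ.* k) ≤_) (regroup q k r) (ℕP.m≤m+n _ (r ℕ.+ k))
      where
      regroup : ∀ q k r → k ℕ.+ (k ℕ.+ q ℕ.* k) ℕ.+ (r ℕ.+ k) ≡ q ℕ.* k ℕ.+ r ℕ.+ (k ℕ.+ (k ℕ.+ k))
      regroup = ℕSolver.solve-∀
    index₃ : k ℕ.+ (k ℕ.+ (k ℕ.+ q ℕ.* k)) ≤ I
    index₃ = subst (k ℕ.+ (k ℕ.+ (k ℕ.+ q ℕ.* k)) ≤_) (regroup q k r) (ℕP.m≤m+n _ r)
      where
      regroup : ∀ q k r → k ℕ.+ (k ℕ.+ (k ℕ.+ q ℕ.* k)) ℕ.+ r ≡ q ℕ.* k ℕ.+ r ℕ.+ (k ℕ.+ (k ℕ.+ k))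
      regroup = ℕSolver.solve-∀
    indexₙ : n ℕ.+ k ≤ I
    indexₙ = subst (n ℕ.+ k ≤_) (ℕP.+-assoc n k (k ℕ.+ k)) (ℕP.m≤m+n (n ℕ.+ k) (k ℕ.+ k))
    swap : ∀ a x y → a ℕ.* (x ℕ.* y) ≡ a ℕ.* y ℕ.* x
    swap = ℕSolver.solve-∀

  2ⁿ≤∣den∣ : ∀ q r → r ≤ k → 2 ℕ.^ (q ℕ.* k ℕ.+ r) ≤ ℤ.∣ den q ∣
  2ⁿ≤∣den∣ q r r≤k = begin
    2 ℕ.^ n                       ≤⟨ ℕP.^-monoˡ-≤ n {2} {p} (s≤s (s≤s z≤n)) ⟩
    p ℕ.^ n                       ≤⟨ ℕP.^-monoʳ-≤ p n≤k*[1+q] ⟩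
    p ℕ.^ (k ℕ.* suc q)           ≡⟨ cong ℤ.∣_∣ (trans (ℤP.^-*-assoc p̂ k (suc q)) (+-^ p (k ℕ.* suc q))) ⟨
    ℤ.∣ P ^ suc q ∣               ≤⟨ ℕP.m≤n*m _ ℤ.∣ Den ∣ ⟩
    ℤ.∣ Den ∣ ℕ.* ℤ.∣ P ^ suc q ∣  ≡⟨ ℤP.abs-* Den (P ^ suc q) ⟨
    ℤ.∣ den q ∣                   ∎
    where
    open ℕP.≤-Reasoning
    n = q ℕ.* k ℕ.+ r
    n≤k*[1+q] : n ≤ k ℕ.* suc q
    n≤k*[1+q] = subst (n ≤_) (regroup q k) (ℕP.+-monoʳ-≤ (q ℕ.* k) r≤k)
      where
      regroup : ∀ q k → q ℕ.* k ℕ.+ k ≡ k ℕ.* suc q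
      regroup = ℕSolver.solve-∀

  ∣e∣*8ⁿ≤C*7ⁿ*∣den∣ : ∀ q r t → r ≤ k → t ≤ k → let n = q ℕ.* k ℕ.+ r in
                      ℤ.∣ - e q r t ∣ ℕ.* 8 ℕ.^ n ≤ C ℕ.* 7 ℕ.^ n ℕ.* ℤ.∣ den q ∣
  ∣e∣*8ⁿ≤C*7ⁿ*∣den∣ q r t r≤k t≤k = begin
    ℤ.∣ - e q r t ∣ ℕ.* 8 ℕ.^ n              ≡⟨ cong₂ ℕ._*_ (ℤP.∣-i∣≡∣i∣ (e q r t)) (8ⁿ≡4ⁿ*2ⁿ n) ⟩
    ℤ.∣ e q r t ∣ ℕ.* (4 ℕ.^ n ℕ.* 2 ℕ.^ n)   ≡⟨ ℕP.*-assoc ℤ.∣ e q r t ∣ _ _ ⟨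
    ℤ.∣ e q r t ∣ ℕ.* 4 ℕ.^ n ℕ.* 2 ℕ.^ n     ≤⟨ ℕP.*-mono-≤ (∣e∣*4ⁿ≤C*7ⁿ q r t t≤k) (2ⁿ≤∣den∣ q r r≤k) ⟩
    C ℕ.* 7 ℕ.^ n ℕ.* ℤ.∣ den q ∣            ∎
    where
    open ℕP.≤-Reasoning
    n = q ℕ.* k ℕ.+ r

  sumsTo-Num/Den : SeriesSumsTo (term X k p m) S
  sumsTo-Num/Den = sumsTo-of-error-bound (term X k p m) S
    (λ n → - e (quot n) (rem n) (k ℕ.∸ rem n)) (λ n → den (quot n)) C
    (λ n → ~-cong (cong (λ j → G j ℚ.- S) (sym (n≡quot*k+rem n)))
                  (remainder-in-block (quot n) (remainder-block-start (quot n)) (rem n) (k ℕ.∸ rem n)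
                                      (ℕP.m+[n∸m]≡n (rem≤k n))))
    (λ n → ℕ.>-nonZero⁻¹ _ {{den-nonZero (quot n)}})
    (λ n → subst (λ j → ℤ.∣ - e (quot n) (rem n) (k ℕ.∸ rem n) ∣ ℕ.* 8 ℕ.^ j ≤ C ℕ.* 7 ℕ.^ j ℕ.* ℤ.∣ den (quot n) ∣)
                 (sym (n≡quot*k+rem n))
                 (∣e∣*8ⁿ≤C*7ⁿ*∣den∣ (quot n) (rem n) _ (rem≤k n) (ℕP.m∸n≤m k (rem n))))
    where
    quot rem : ℕ → ℕ
    quot n = n ℕDiv./ k
    rem n = n ℕDiv.% k
    n≡quot*k+rem : ∀ n → n ≡ quot n ℕ.* k ℕ.+ rem n
    n≡quot*k+rem n = trans (ℕDiv.m≡m%n+[m/n]*n n k) (ℕP.+-comm (rem n) (quot n ℕ.* k))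
    rem≤k : ∀ n → rem n ≤ k
    rem≤k n = ℕP.<⇒≤ (ℕDiv.m%n<n n k)

  τ : ℤ
  τ = sgnℤ (c + + 0)

  sgnℤ-m : sgnℤ m ≡ τ * (- 1ℤ * σ)
  sgnℤ-m = begin
    sgnℤ m                   ≡⟨ cong sgnℤ (regroup m (+ k)) ⟩
    sgnℤ (c + + suc k)       ≡⟨ sgnℤ-+ c (suc k) ⟩
    sgnℤ c * sgn (suc k)     ≡⟨ cong (λ v → sgnℤ v * sgn (suc k)) (ℤP.+-identityʳ c) ⟨
    τ * (- 1ℤ * σ)           ∎
    where
    open ≡-Reasoning
    regroup : ∀ m k → m ≡ (m - k - + 1) + (+ 1 + k)
    regroup = solve-∀

  sgnℤ-c+1 : sgnℤ (c + + 1) ≡ - τ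
  sgnℤ-c+1 = trans (sgnℤ-suc c) (cong (λ v → - sgnℤ v) (sym (ℤP.+-identityʳ c)))

  k-m+1≡-[c+0] : + k - m + + 1 ≡ - (c + + 0)
  k-m+1≡-[c+0] = regroup m (+ k)
    where
    regroup : ∀ m k → k - m + + 1 ≡ - ((m - k - + 1) + + 0)
    regroup = solve-∀

  k-m≡-[c+1] : + k - m ≡ - (c + + 1)
  k-m≡-[c+1] = regroup m (+ k)
    where
    regroup : ∀ m k → k - m ≡ - ((m - k - + 1) + + 1)
    regroup = solve-∀

  p̂X[m]+X[m-1]≡Z₁ : p̂ * X m + X (m - + 1) ≡ Z 1
  p̂X[m]+X[m-1]≡Z₁ = cong₂ (λ i j → p̂ * X i + X j) (index₁ m (+ k)) (index₀ m (+ k))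
    where
    index₁ : ∀ m k → m ≡ (m - k - + 1) + (+ 1 + (k + + 0))
    index₁ = solve-∀
    index₀ : ∀ m k → m - + 1 ≡ (m - k - + 1) + (k + + 0)
    index₀ = solve-∀

  p̂X[k+m]+X[k+m-1]≡Z₂ : p̂ * X (+ k + m) + X (+ k + m - + 1) ≡ Z 2
  p̂X[k+m]+X[k+m-1]≡Z₂ = cong₂ (λ i j → p̂ * X i + X j) (index₁ m (+ k)) (index₀ m (+ k))
    where
    index₁ : ∀ m k → k + m ≡ (m - k - + 1) + (+ 1 + (k + (k + + 0)))
    index₁ = solve-∀
    index₀ : ∀ m k → k + m - + 1 ≡ (m - k - + 1) + (k + (k + + 0))
    index₀ = solve-∀

  p̂^2k≡P*P : p̂ ^ (2 *ℕ k) ≡ P * P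
  p̂^2k≡P*P = trans (ℤP.^-distribˡ-+-* p̂ k (k ℕ.+ 0)) (cong (λ v → P * p̂ ^ v) (ℕP.+-identityʳ k))

  -- R is the term at the reflected indices k - m and k + 1 - m, where F and L differ.
  sumsTo-closed-form : ∀ R → σ * P * Z 0 ≡ R →
    SeriesSumsTo (term X k p m)
      ((((p̂ ^ (2 *ℕ k) - σ) * (p̂ * X m + X (m - + 1))
          - P * (p̂ * X (+ k + m) + X (+ k + m - + 1)) + R) / 1)
        ÷₀ (((p̂ ^ 2 - p̂ - + 1) * (p̂ ^ (2 *ℕ k) + P * L (+ k) + σ)) / 1))
  sumsTo-closed-form R σPZ₀≡R =
    subst₂ (λ N D → SeriesSumsTo (term X k p m) ((N / 1) ÷₀ (D / 1))) (sym numerator≡) (sym denominator≡)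
      sumsTo-Num/Den
    where
    open ≡-Reasoning
    numerator≡ : (p̂ ^ (2 *ℕ k) - σ) * (p̂ * X m + X (m - + 1)) - P * (p̂ * X (+ k + m) + X (+ k + m - + 1)) + R
                 ≡ Num
    numerator≡ = begin
      (p̂ ^ (2 *ℕ k) - σ) * (p̂ * X m + X (m - + 1)) - P * (p̂ * X (+ k + m) + X (+ k + m - + 1)) + R
        ≡⟨ cong₂ (λ x y → (x - σ) * y - P * (p̂ * X (+ k + m) + X (+ k + m - + 1)) + R)
                 p̂^2k≡P*P p̂X[m]+X[m-1]≡Z₁ ⟩
      (P * P - σ) * Z 1 - P * (p̂ * X (+ k + m) + X (+ k + m - + 1)) + R
        ≡⟨ cong₂ (λ y z → (P * P - σ) * Z 1 - P * y + z) p̂X[k+m]+X[k+m-1]≡Z₂ (sym σPZ₀≡R) ⟩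
      Num ∎
    denominator≡ : (p̂ ^ 2 - p̂ - + 1) * (p̂ ^ (2 *ℕ k) + P * L (+ k) + σ) ≡ Den
    denominator≡ = cong₂ (λ x y → (p̂ * x - p̂ - + 1) * (y + P * Lₖ + σ)) (ℤP.*-identityʳ p̂) p̂^2k≡P*P

F-reflected : ∀ k₀ p₀ m → let open BlockSignedSeries k₀ p₀ F F-recurrence m in
              σ * P * Z 0 ≡ sgnℤ m * P * (F (+ k - m + + 1) - p̂ * F (+ k - m))
F-reflected k₀ p₀ m = sym (begin
  sgnℤ m * P * (F (+ k - m + + 1) - p̂ * F (+ k - m))
    ≡⟨ cong₂ (λ x y → sgnℤ m * P * (F x - p̂ * F y)) k-m+1≡-[c+0] k-m≡-[c+1] ⟩
  sgnℤ m * P * (F (- (c + + 0)) - p̂ * F (- (c + + 1)))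
    ≡⟨ cong₂ (λ x y → sgnℤ m * P * (x - p̂ * y)) (F-neg (c + + 0)) (F-neg (c + + 1)) ⟩
  sgnℤ m * P * (- (τ * a 0) - p̂ * - (sgnℤ (c + + 1) * a 1))
    ≡⟨ cong₂ (λ x y → x * P * (- (τ * a 0) - p̂ * - (y * a 1))) sgnℤ-m sgnℤ-c+1 ⟩
  τ * (- 1ℤ * σ) * P * (- (τ * a 0) - p̂ * - (- τ * a 1))
    ≡⟨ polynomial τ σ P p̂ (a 0) (a 1) ⟩
  (τ * τ) * (σ * P * Z 0)
    ≡⟨ cong (_* (σ * P * Z 0)) (sgn*sgn≡1 ℤ.∣ c + + 0 ∣) ⟩
  1ℤ * (σ * P * Z 0)
    ≡⟨ ℤP.*-identityˡ (σ * P * Z 0) ⟩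
  σ * P * Z 0 ∎)
  where
  open BlockSignedSeries k₀ p₀ F F-recurrence m
  open ≡-Reasoning
  polynomial : ∀ u σ P p a₀ a₁ →
    u * (- 1ℤ * σ) * P * (- (u * a₀) - p * - (- u * a₁)) ≡ (u * u) * (σ * P * (p * a₁ + a₀))
  polynomial = solve-∀

L-reflected : ∀ k₀ p₀ m → let open BlockSignedSeries k₀ p₀ L L-recurrence m in
              σ * P * Z 0 ≡ - (sgnℤ m * P * (L (+ k - m + + 1) - p̂ * L (+ k - m)))
L-reflected k₀ p₀ m = sym (begin
  - (sgnℤ m * P * (L (+ k - m + + 1) - p̂ * L (+ k - m)))
    ≡⟨ cong₂ (λ x y → - (sgnℤ m * P * (L x - p̂ * L y))) k-m+1≡-[c+0] k-m≡-[c+1] ⟩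
  - (sgnℤ m * P * (L (- (c + + 0)) - p̂ * L (- (c + + 1))))
    ≡⟨ cong₂ (λ x y → - (sgnℤ m * P * (x - p̂ * y))) (L-neg (c + + 0)) (L-neg (c + + 1)) ⟩
  - (sgnℤ m * P * (τ * a 0 - p̂ * (sgnℤ (c + + 1) * a 1)))
    ≡⟨ cong₂ (λ x y → - (x * P * (τ * a 0 - p̂ * (y * a 1)))) sgnℤ-m sgnℤ-c+1 ⟩
  - (τ * (- 1ℤ * σ) * P * (τ * a 0 - p̂ * (- τ * a 1)))
    ≡⟨ polynomial τ σ P p̂ (a 0) (a 1) ⟩
  (τ * τ) * (σ * P * Z 0)
    ≡⟨ cong (_* (σ * P * Z 0)) (sgn*sgn≡1 ℤ.∣ c + + 0 ∣) ⟩
  1ℤ * (σ * P * Z 0)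
    ≡⟨ ℤP.*-identityˡ (σ * P * Z 0) ⟩
  σ * P * Z 0 ∎)
  where
  open BlockSignedSeries k₀ p₀ L L-recurrence m
  open ≡-Reasoning
  polynomial : ∀ u σ P p a₀ a₁ →
    - (u * (- 1ℤ * σ) * P * (u * a₀ - p * (- u * a₁))) ≡ (u * u) * (σ * P * (p * a₁ + a₀))
  polynomial = solve-∀

theorem33 : (k : ℕ) .{{_ : NonZero k}} (p : ℕ) → 2 ≤ p → (m : ℤ) →
    SeriesSumsTo (term F k p m)
      (((((+ p) ^ (2 *ℕ k)) - sgn k) * ((+ p) * F m + F (m - + 1))
          - ((+ p) ^ k) * ((+ p) * F (+ k + m) + F (+ k + m - + 1))
          + sgnℤ m * ((+ p) ^ k) * (F (+ k - m + + 1) - (+ p) * F (+ k - m))) / 1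
        ÷₀ ((((+ p) ^ 2 - + p - + 1) * ((+ p) ^ (2 *ℕ k) + ((+ p) ^ k) * L (+ k) + sgn k)) / 1))
    ×
    SeriesSumsTo (term L k p m)
      (((((+ p) ^ (2 *ℕ k)) - sgn k) * ((+ p) * L m + L (m - + 1))
          - ((+ p) ^ k) * ((+ p) * L (+ k + m) + L (+ k + m - + 1))
          - sgnℤ m * ((+ p) ^ k) * (L (+ k - m + + 1) - (+ p) * L (+ k - m))) / 1
        ÷₀ ((((+ p) ^ 2 - + p - + 1) * ((+ p) ^ (2 *ℕ k) + ((+ p) ^ k) * L (+ k) + sgn k)) / 1))
theorem33 zero {{k≢0}} p 2≤p m = Irrelevant.⊥-elim (NonZero.nonZero k≢0)
theorem33 (suc k₀) (suc (suc p₀)) (s≤s (s≤s _)) m =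
  BlockSignedSeries.sumsTo-closed-form k₀ p₀ F F-recurrence m _ (F-reflected k₀ p₀ m) ,
  BlockSignedSeries.sumsTo-closed-form k₀ p₀ L L-recurrence m _ (L-reflected k₀ p₀ m)
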